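{- Let $D$ be a digraph with an even number $n$ of vertices, and let $\Gamma$ and $\vec\Gamma$ be obtained from $D$ by Procedure 1 (for some fixed outcome of the permutation). If $M_1,M_2$ are edge-disjoint perfect matchings in $\Gamma$, then their associated directed Hamilton cycles $\vec M_1,\vec M_2$ are edge-disjoint in $\vec\Gamma$.
   Context: Digraphs have no loops and no repeated edges in the same direction (both directions between a pair are allowed). Procedure 1 on a digraph $D$ with $n$ vertices, $n$ even: (1) take a uniformly random ordering $v_1,\dots,v_n$ of the vertices, and let $A=\{v_1,\dots,v_{n/2}\}$, $B=\{v_{n/2+1},\dots,v_n\}$. (2) The successor of $v_i$ is $v_{i+1}$, except that the successor of $v_{n/2}$ is $v_1$ and the successor of $v_n$ is $v_{n/2+1}$; the predecessor is defined inversely. (3) $\Gamma$ is the bipartite graph on $A\cup B$ with $v_iv_j$ ($v_i\in A$, $v_j\in B$) an edge iff both $\overrightarrow{v_iv_j}$ and $\overrightarrow{v_jv_{i^+}}$ are edges of $D$, where $v_{i^+}$ is the successor of $v_i$. (4) $\vec\Gamma\subseteq D$ is the digraph consisting of the edges $\overrightarrow{v_iv_j},\overrightarrow{v_jv_{i^+}}$ for all edges $v_iv_j\in\Gamma$ with $v_i\in A$. Given a perfect matching $M$ of $\Gamma$ matching each $v_i\in A$ to $v_{i'}\in B$, its associated Hamilton cycle $\vec M$ is the directed cycle $(v_1,v_{1'},v_2,v_{2'},\dots,v_{n/2},v_{(n/2)'})$ in $\vec\Gamma$. -}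

module Defs where

open import Data.Nat as ℕ using (ℕ; _+_)
open import Data.Fin using (Fin; zero; suc; toℕ; lower₁; _↑ˡ_; _↑ʳ_)
open import Data.Fin.Permutation using (Permutation′; _⟨$⟩ʳ_)
open import Data.Product using (Σ; _×_; ∃)
open import Data.Sum using (_⊎_)
open import Relation.Nullary using (¬_; yes; no)
open import Relation.Binary.PropositionalEquality using (_≡_)


-- A digraph on the vertex set Fin N: an irreflexive arc relation.
-- (A relation automatically has no repeated arcs in the same direction;
--  both directions between a pair are allowed.)
record Digraph (N : ℕ) : Set₁ where
  field
    Arc      : Fin N → Fin N → Set
    loopless : ∀ x → ¬ Arc x x
open Digraph public

sucMod : ∀ {m} → Fin m → Fin m
sucMod {ℕ.suc k} i with k ℕ.≟ toℕ i
... | yes _ = zero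
... | no ne = suc (lower₁ i ne)

-- Procedure 1 with n = m + m vertices and a fixed ordering σ
-- (σ maps position p ∈ {0,…,n-1} to the vertex v_{p+1}).
module Procedure1 {m : ℕ} (D : Digraph (m + m)) (σ : Permutation′ (m + m)) where

  -- the i-th vertex of A  (v_{i+1}), and the j-th vertex of B (v_{m+j+1})
  vA : Fin m → Fin (m + m)
  vA i = σ ⟨$⟩ʳ (i ↑ˡ m)

  vB : Fin m → Fin (m + m)
  vB j = σ ⟨$⟩ʳ (m ↑ʳ j)

  vA⁺ : Fin m → Fin (m + m)
  vA⁺ i = vA (sucMod i)

  ΓEdge : Fin m → Fin m → Set
  ΓEdge i j = Arc D (vA i) (vB j) × Arc D (vB j) (vA⁺ i)

  ΓArc : Fin (m + m) → Fin (m + m) → Set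
  ΓArc x y = ∃ λ i → ∃ λ j → ΓEdge i j ×
               ((x ≡ vA i × y ≡ vB j) ⊎ (x ≡ vB j × y ≡ vA⁺ i))

  -- a perfect matching of Γ: a bijection A → B (i ↦ M i) using only Γ-edges
  record PerfectMatching : Set where
    field
      match   : Permutation′ m
      isEdge  : ∀ i → ΓEdge i (match ⟨$⟩ʳ i)
  open PerfectMatching public

  EdgeDisjointPM : PerfectMatching → PerfectMatching → Set
  EdgeDisjointPM M₁ M₂ = ∀ i j → match M₁ ⟨$⟩ʳ i ≡ j → match M₂ ⟨$⟩ʳ i ≡ j → Data.Empty.⊥
    where import Data.Empty

  -- arcs of the associated Hamilton cycle M⃗ = (v_1, v_1', v_2, v_2', …)
  CycleArc : PerfectMatching → Fin (m + m) → Fin (m + m) → Set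
  CycleArc M x y = ∃ λ i →
      (x ≡ vA i × y ≡ vB (match M ⟨$⟩ʳ i))
    ⊎ (x ≡ vB (match M ⟨$⟩ʳ i) × y ≡ vA⁺ i)

  EdgeDisjointCycles : PerfectMatching → PerfectMatching → Set
  EdgeDisjointCycles M₁ M₂ = ∀ x y → CycleArc M₁ x y → CycleArc M₂ x y → Data.Empty.⊥
    where import Data.Empty

module Submission where

-- Two arcs of the Hamilton cycles M⃗₁, M⃗₂ can only coincide if they come
-- from the same edge of Γ.  Every arc of M⃗ either leaves the A-vertex
-- v_i towards its partner M(i) ∈ B, or leaves M(i) towards the successor
-- v_{i⁺}.  The map σ placing positions on vertices is injective, the
-- A-half and the B-half of the positions are disjoint, and the cyclic
-- successor on A is injective.  Hence a common arc of M⃗₁ and M⃗₂ is of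
-- the same kind in both cycles, its A-endpoint determines the same index
-- i in both, and its B-endpoint then gives M₁(i) = M₂(i): the matchings
-- share the edge v_i M₁(i), contradicting their edge-disjointness.

open import Defs
open import Data.Nat using (ℕ; suc; _+_; _≟_)
open import Data.Fin using (Fin; suc; toℕ; splitAt; _↑ˡ_; _↑ʳ_)
open import Data.Fin.Properties
  using (toℕ-injective; suc-injective; lower₁-injective; ↑ˡ-injective; ↑ʳ-injective; splitAt-↑ˡ; splitAt-↑ʳ)
open import Data.Fin.Permutation using (Permutation; Permutation′; _⟨$⟩ʳ_)
open import Data.Product using (∃; _,_)
open import Data.Sum using (inj₁; inj₂)
open import Function.Bundles using (Injection)
open import Function.Properties.Inverse using (↔⇒↣)
open import Relation.Nullary using (yes; no)
open import Relation.Binary.PropositionalEquality using (_≡_; _≢_; refl; sym; trans; cong)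

permutation-injective : ∀ {m n} (π : Permutation m n) {i j : Fin m} →
                        π ⟨$⟩ʳ i ≡ π ⟨$⟩ʳ j → i ≡ j
permutation-injective π = Injection.injective (↔⇒↣ π)

-- The left and right copies of Fin m and Fin n inside Fin (m + n) are
-- disjoint: splitAt sends them to different summands.
↑ˡ≢↑ʳ : ∀ {m n} (i : Fin m) (j : Fin n) → i ↑ˡ n ≢ m ↑ʳ j
↑ˡ≢↑ʳ {m} {n} i j eq
  with () ← trans (sym (splitAt-↑ˡ m i n)) (trans (cong (splitAt m) eq) (splitAt-↑ʳ m n j))

sucMod-injective : ∀ {m} {i j : Fin m} → sucMod i ≡ sucMod j → i ≡ j
sucMod-injective {suc k} {i} {j} eq with k ≟ toℕ i | k ≟ toℕ j
... | yes k≡i | yes k≡j = toℕ-injective (trans (sym k≡i) k≡j)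
... | yes _   | no  _   with () ← eq
... | no  _   | yes _   with () ← eq
... | no  _   | no  _   = lower₁-injective (suc-injective eq)

module _ {m : ℕ} (D : Digraph (m + m)) (σ : Permutation′ (m + m)) where
  open Procedure1 {m} D σ

  vA-injective : ∀ {i i′} → vA i ≡ vA i′ → i ≡ i′
  vA-injective eq = ↑ˡ-injective m _ _ (permutation-injective σ eq)

  vB-injective : ∀ {j j′} → vB j ≡ vB j′ → j ≡ j′
  vB-injective eq = ↑ʳ-injective m _ _ (permutation-injective σ eq)

  vA⁺-injective : ∀ {i i′} → vA⁺ i ≡ vA⁺ i′ → i ≡ i′
  vA⁺-injective eq = sucMod-injective (vA-injective eq)

  vA≢vB : ∀ i j → vA i ≢ vB j
  vA≢vB i j eq = ↑ˡ≢↑ʳ i j (permutation-injective σ eq)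

  SharedEdge : PerfectMatching → PerfectMatching → Set
  SharedEdge M₁ M₂ = ∃ λ i → match M₁ ⟨$⟩ʳ i ≡ match M₂ ⟨$⟩ʳ i

  sharedArc⇒sharedEdge : ∀ M₁ M₂ {x y} → CycleArc M₁ x y → CycleArc M₂ x y →
                         SharedEdge M₁ M₂
  sharedArc⇒sharedEdge M₁ M₂ (i , inj₁ (refl , refl)) (i′ , inj₁ (x≡ , y≡))
    with vA-injective x≡
  ... | refl = i , vB-injective y≡
  sharedArc⇒sharedEdge M₁ M₂ (i , inj₂ (refl , refl)) (i′ , inj₂ (x≡ , y≡))
    with vA⁺-injective y≡
  ... | refl = i , vB-injective x≡
  sharedArc⇒sharedEdge M₁ M₂ (i , inj₁ (refl , _)) (i′ , inj₂ (x≡ , _))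
    with () ← vA≢vB i _ x≡
  sharedArc⇒sharedEdge M₁ M₂ (i , inj₂ (refl , _)) (i′ , inj₁ (x≡ , _))
    with () ← vA≢vB i′ _ (sym x≡)

lemma3p3 : (m : ℕ) (D : Digraph (m + m)) (σ : Permutation′ (m + m))
    → (M₁ M₂ : Procedure1.PerfectMatching {m} D σ)
    → Procedure1.EdgeDisjointPM {m} D σ M₁ M₂
    → Procedure1.EdgeDisjointCycles {m} D σ M₁ M₂
lemma3p3 m D σ M₁ M₂ disjoint x y arc₁ arc₂
  with i , shared ← sharedArc⇒sharedEdge D σ M₁ M₂ arc₁ arc₂
  = disjoint i _ refl (sym shared)
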